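{- Let \( \mathfrak{X} = (V, X) \) be a homogeneous coherent configuration, and let \( G \in X \) be a connected symmetric relation of degree \( k \) and diameter \( d \), viewed as an undirected \( k \)-regular graph on \( V \). Then for every nonempty \( S \subseteq V \) with \( |S| \leq |V|/2 \) we have \[ \frac{|\delta_G(S)|}{|S|} \geq \frac{k}{2d}, \] where \( \delta_G(S) \) is the set of edges of \( G \) joining \( S \) with \( V \setminus S \).
   Context: A homogeneous coherent configuration is a pair \( (V,X) \) where \( V \) is a finite set and \( X \) is a partition of \( V\times V \) such that: the diagonal \( \{(v,v)\} \) belongs to \( X \); the transpose of every relation in \( X \) is in \( X \); and for all \( R,S,T\in X \) and \( (u,v)\in R \), the number of \( w \) with \( (u,w)\in S \), \( (w,v)\in T \) depends only on \( R,S,T \). A relation is symmetric if it equals its transpose. -}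

module Defs where

open import Data.Nat using (ℕ; zero; suc; _+_; _*_; _≤_)
open import Data.Fin using (Fin; _≟_)
open import Data.Fin.Subset using (Subset; _∈_; _∉_; ∣_∣; Nonempty)
open import Data.List using (List; map; allFin)
open import Data.Nat.ListAction using (sum)
open import Data.Bool using (Bool; true; false; if_then_else_; _∧_; not)
open import Data.Product using (Σ; ∃; _×_; _,_)
open import Relation.Nullary using (¬_)
open import Relation.Nullary.Decidable using (⌊_⌋)
open import Relation.Binary.PropositionalEquality using (_≡_)
open import Data.Vec using (lookup)
open import Function.Bundles using (_⇔_)

count : (n : ℕ) → (Fin n → Bool) → ℕ
count n f = sum (map (λ i → if f i then 1 else 0) (allFin n))

-- A homogeneous coherent configuration on V = Fin n with r relations,
-- given as the colouring  c : V → V → Fin r  (the relation containing (u,v));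
-- the relations are the colour classes R_i = { (u,v) | c u v ≡ i }.
record IsHCC (n r : ℕ) (c : Fin n → Fin n → Fin r) : Set where
  field
    nonempty   : ∀ (i : Fin r) → ∃ λ u → ∃ λ v → c u v ≡ i
    diag       : Fin r
    diag-spec  : ∀ u v → (c u v ≡ diag) ⇔ (u ≡ v)
    transp     : Fin r → Fin r
    transp-spec : ∀ i u v → (c u v ≡ i) ⇔ (c v u ≡ transp i)
    coherent   : ∀ (i j l : Fin r) (u v u' v' : Fin n) →
                 c u v ≡ l → c u' v' ≡ l →
                 count n (λ w → ⌊ c u w ≟ i ⌋ ∧ ⌊ c w v ≟ j ⌋)
                   ≡ count n (λ w → ⌊ c u' w ≟ i ⌋ ∧ ⌊ c w v' ≟ j ⌋)

module _ {n r : ℕ} (c : Fin n → Fin n → Fin r) (g : Fin r) where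

  Symmetric : Set
  Symmetric = ∀ u v → c u v ≡ g → c v u ≡ g

  HasDegree : ℕ → Set
  HasDegree k = ∀ u → count n (λ v → ⌊ c u v ≟ g ⌋) ≡ k

  data Walk : Fin n → Fin n → ℕ → Set where
    here : ∀ {u} → Walk u u zero
    step : ∀ {u v w ℓ} → c u v ≡ g → Walk v w ℓ → Walk u w (suc ℓ)

  Connected : Set
  Connected = ∀ u v → ∃ λ ℓ → Walk u v ℓ

  HasDiameter : ℕ → Set
  HasDiameter d =
    (∀ u v → ∃ λ ℓ → ℓ ≤ d × Walk u v ℓ) ×
    (∃ λ u → ∃ λ v → ∀ ℓ → Walk u v ℓ → d ≤ ℓ)

  -- |δ_G(S)|: number of edges {u,v} of g with u ∈ S, v ∉ S
  -- (for symmetric g these correspond bijectively to ordered pairs (u,v), u ∈ S, v ∉ S)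
  boundary : Subset n → ℕ
  boundary S = sum (map (λ u → count n (λ v → ⌊ c u v ≟ g ⌋ ∧ lookup S u ∧ not (lookup S v))) (allFin n))

-- Let every ordered pair (x, y) send one unit of flow, spread over the lazy walks of length d from
-- x to y (each step stays put or follows an edge of G) in proportion 1 / W(x, y), where
-- W = (I + A)^d is positive because d is the diameter.  The load this flow puts on an edge is an
-- entry of a matrix in the Bose–Mesner algebra of the configuration, so every edge of G carries the
-- same load λ.  A walk of length d has at most d edge steps, so n k λ ≤ n² d; every pair with
-- x ∈ S, y ∉ S must cross the boundary, so |S| |V∖S| ≤ |δ(S)| λ; and |V∖S| ≥ n/2.  To stay in ℕ
-- all weights are multiplied by a common multiple of the entries of W.

module Submission where

open import Defs
open import Data.Nat using (ℕ; zero; suc; _+_; _*_; _≤_; _<_; _!; z≤n; s≤s; NonZero; >-nonZero)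
open import Data.Nat.Properties hiding (_≟_)
open import Data.Nat.Divisibility using (_∣_; ∣-trans; m∣m*n; m≤n⇒m!∣n!)
open import Data.Nat.ListAction using (sum)
open import Data.Nat.Tactic.RingSolver using (solve-∀)
open import Data.Fin using (Fin; zero; suc; _≟_)
open import Data.Fin.Subset using (Subset; ∣_∣; Nonempty)
open import Data.Fin.Properties using (nonZeroIndex)
open import Data.List using (map; allFin; tabulate)
open import Data.List.Properties using (map-tabulate)
open import Data.Vec using (lookup; []; _∷_)
open import Data.Bool using (Bool; true; false; if_then_else_; _∧_; not)
open import Data.Bool.Properties using (∧-identityʳ)
open import Data.Product using (_,_; proj₁; proj₂)
open import Relation.Nullary using (Dec; yes; no)
open import Relation.Nullary.Decidable using (⌊_⌋; isYes≗does; does-⇔; dec-true; dec-false; ⌊⌋-map′)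
open import Relation.Binary.PropositionalEquality
open import Function using (_∘_; id)
open import Function.Bundles using (_⇔_; Equivalence)
open import Algebra.Properties.Semiring.Sum +-*-semiring
  using (sum-cong-≗; sum-replicate-zero; ∑-distrib-+; ∑-comm; *-distribˡ-sum; *-distribʳ-sum)
  renaming (sum to ∑)

∑-mono-≤ : ∀ {n} {f g : Fin n → ℕ} → (∀ i → f i ≤ g i) → ∑ f ≤ ∑ g
∑-mono-≤ {zero}  _   = z≤n
∑-mono-≤ {suc n} f≤g = +-mono-≤ (f≤g zero) (∑-mono-≤ (f≤g ∘ suc))

term≤∑ : ∀ {n} (f : Fin n → ℕ) i → f i ≤ ∑ f
term≤∑ f zero    = m≤m+n _ _
term≤∑ f (suc i) = ≤-trans (term≤∑ (f ∘ suc) i) (m≤n+m _ _)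

∑-const : ∀ {n} a → ∑ {n} (λ _ → a) ≡ n * a
∑-const {zero}  a = refl
∑-const {suc n} a = cong (a +_) (∑-const {n} a)

sum-map-allFin : ∀ {n} (f : Fin n → ℕ) → sum (map f (allFin n)) ≡ ∑ f
sum-map-allFin f = trans (cong sum (map-tabulate id f)) (sum-tabulate f)
  where
  sum-tabulate : ∀ {n} (f : Fin n → ℕ) → sum (tabulate f) ≡ ∑ f
  sum-tabulate {zero}  f = refl
  sum-tabulate {suc n} f = cong (f zero +_) (sum-tabulate (f ∘ suc))

∣∑! : ∀ {m} (f : Fin m → ℕ) → (∀ i → 0 < f i) → ∀ i → f i ∣ ∑ f !
∣∑! f f>0 i with f i | f>0 i | term≤∑ f i
... | suc j | _ | fᵢ≤∑ = ∣-trans (m∣m*n (j !)) (m≤n⇒m!∣n! fᵢ≤∑)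

⟦_⟧ : Bool → ℕ
⟦ b ⟧ = if b then 1 else 0

⟦∧⟧ : ∀ a b → ⟦ a ∧ b ⟧ ≡ ⟦ a ⟧ * ⟦ b ⟧
⟦∧⟧ true  b = sym (+-identityʳ ⟦ b ⟧)
⟦∧⟧ false b = refl

⟦⟧+⟦not⟧ : ∀ b → ⟦ b ⟧ + ⟦ not b ⟧ ≡ 1
⟦⟧+⟦not⟧ true  = refl
⟦⟧+⟦not⟧ false = refl

∣p∣≡∑ : ∀ {n} (p : Subset n) → ∣ p ∣ ≡ ∑ (λ i → ⟦ lookup p i ⟧)
∣p∣≡∑ []          = refl
∣p∣≡∑ (true ∷ p)  = cong suc (∣p∣≡∑ p)
∣p∣≡∑ (false ∷ p) = ∣p∣≡∑ p

∣p∣+∑⟦not⟧≡n : ∀ {n} (p : Subset n) → ∣ p ∣ + ∑ (λ i → ⟦ not (lookup p i) ⟧) ≡ n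
∣p∣+∑⟦not⟧≡n {n} p = begin
  ∣ p ∣ + ∑ (λ i → ⟦ not (lookup p i) ⟧)                    ≡⟨ cong (_+ ∑ ⟦not⟧) (∣p∣≡∑ p) ⟩
  ∑ (λ i → ⟦ lookup p i ⟧) + ∑ (λ i → ⟦ not (lookup p i) ⟧) ≡⟨ ∑-distrib-+ {n} _ _ ⟨
  ∑ (λ i → ⟦ lookup p i ⟧ + ⟦ not (lookup p i) ⟧)           ≡⟨ sum-cong-≗ {n} (⟦⟧+⟦not⟧ ∘ lookup p) ⟩
  ∑ {n} (λ _ → 1)                                           ≡⟨ ∑-const {n} 1 ⟩
  n * 1                                                     ≡⟨ *-identityʳ n ⟩
  n                                                         ∎
  where
  open ≡-Reasoning
  ⟦not⟧ : Fin n → ℕ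
  ⟦not⟧ i = ⟦ not (lookup p i) ⟧

⌊⌋-⇔ : ∀ {a b} {A : Set a} {B : Set b} → A ⇔ B → (a? : Dec A) (b? : Dec B) → ⌊ a? ⌋ ≡ ⌊ b? ⌋
⌊⌋-⇔ A⇔B a? b? = trans (isYes≗does a?) (trans (does-⇔ A⇔B a? b?) (sym (isYes≗does b?)))

δ : ∀ {n} → Fin n → Fin n → ℕ
δ a i = ⟦ ⌊ a ≟ i ⌋ ⟧

δ-refl : ∀ {n} (a : Fin n) → δ a a ≡ 1
δ-refl a = cong ⟦_⟧ (trans (isYes≗does (a ≟ a)) (dec-true (a ≟ a) refl))

δ-≢ : ∀ {n} {a i : Fin n} → a ≢ i → δ a i ≡ 0
δ-≢ {a = a} {i} a≢i = cong ⟦_⟧ (trans (isYes≗does (a ≟ i)) (dec-false (a ≟ i) a≢i))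

δ-sum : ∀ {n} (a : Fin n) (F : Fin n → ℕ) → ∑ (λ i → δ a i * F i) ≡ F a
δ-sum {suc n} zero F = begin
  F zero + 0 + ∑ {n} (λ _ → 0) ≡⟨ cong (F zero + 0 +_) (sum-replicate-zero n) ⟩
  F zero + 0 + 0               ≡⟨ +-identityʳ _ ⟩
  F zero + 0                   ≡⟨ +-identityʳ _ ⟩
  F zero                       ∎
  where open ≡-Reasoning
δ-sum {suc n} (suc a) F = begin
  ∑ (λ i → δ (suc a) (suc i) * F (suc i))
    ≡⟨ sum-cong-≗ {n} (λ i → cong (λ b → ⟦ b ⟧ * F (suc i)) (⌊⌋-map′ _ _ (a ≟ i))) ⟩
  ∑ (λ i → δ a i * F (suc i))
    ≡⟨ δ-sum a (F ∘ suc) ⟩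
  F (suc a) ∎
  where open ≡-Reasoning

Matrix : ℕ → Set
Matrix n = Fin n → Fin n → ℕ

module _ {n : ℕ} where

  infixl 7 _⊗_
  infixl 6 _⊕_

  _⊗_ : Matrix n → Matrix n → Matrix n
  (M ⊗ N) x y = ∑ λ z → M x z * N z y

  _⊕_ : Matrix n → Matrix n → Matrix n
  (M ⊕ N) x y = M x y + N x y

  _ᵀ : Matrix n → Matrix n
  (M ᵀ) x y = M y x

  𝟘 : Matrix n
  𝟘 _ _ = 0

  𝟙 : Matrix n
  𝟙 = δ

  total : Matrix n → ℕ
  total M = ∑ λ x → ∑ λ y → M x y

  ⟨_,_⟩ : Matrix n → Matrix n → ℕ
  ⟨ Y , M ⟩ = ∑ λ x → ∑ λ y → Y x y * M x y

  ⟨⟩-zeroʳ : ∀ Y → ⟨ Y , 𝟘 ⟩ ≡ 0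
  ⟨⟩-zeroʳ Y = begin
    ∑ (λ x → ∑ λ y → Y x y * 0) ≡⟨ sum-cong-≗ {n} (λ x → sum-cong-≗ {n} (λ y → *-zeroʳ (Y x y))) ⟩
    ∑ {n} (λ x → ∑ {n} λ y → 0) ≡⟨ sum-cong-≗ {n} (λ x → sum-replicate-zero n) ⟩
    ∑ {n} (λ x → 0)             ≡⟨ sum-replicate-zero n ⟩
    0                           ∎
    where open ≡-Reasoning

  ⟨⟩-distribˡ-⊕ : ∀ Y M N → ⟨ Y , M ⊕ N ⟩ ≡ ⟨ Y , M ⟩ + ⟨ Y , N ⟩
  ⟨⟩-distribˡ-⊕ Y M N = begin
    ∑ (λ x → ∑ λ y → Y x y * (M x y + N x y))
      ≡⟨ sum-cong-≗ {n} (λ x → sum-cong-≗ {n} (λ y → *-distribˡ-+ (Y x y) (M x y) (N x y))) ⟩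
    ∑ (λ x → ∑ λ y → Y x y * M x y + Y x y * N x y)
      ≡⟨ sum-cong-≗ {n} (λ x → ∑-distrib-+ {n} (λ y → Y x y * M x y) (λ y → Y x y * N x y)) ⟩
    ∑ (λ x → ∑ (λ y → Y x y * M x y) + ∑ (λ y → Y x y * N x y))
      ≡⟨ ∑-distrib-+ {n} _ _ ⟩
    ⟨ Y , M ⟩ + ⟨ Y , N ⟩ ∎
    where open ≡-Reasoning

  ⟨⟩-constʳ : ∀ Z a → ⟨ Z , (λ _ _ → a) ⟩ ≡ total Z * a
  ⟨⟩-constʳ Z a = begin
    ∑ (λ x → ∑ λ y → Z x y * a) ≡⟨ sum-cong-≗ {n} (λ x → *-distribʳ-sum a (Z x)) ⟨
    ∑ (λ x → ∑ (Z x) * a)       ≡⟨ *-distribʳ-sum a (λ x → ∑ (Z x)) ⟨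
    total Z * a                 ∎
    where open ≡-Reasoning

  ⟨⟩-⊗-transposeʳ : ∀ Y M N → ⟨ Y , M ⊗ N ⟩ ≡ ⟨ M , Y ⊗ N ᵀ ⟩
  ⟨⟩-⊗-transposeʳ Y M N = begin
    ∑ (λ x → ∑ λ y → Y x y * ∑ (λ z → M x z * N z y))
      ≡⟨ sum-cong-≗ {n} (λ x → sum-cong-≗ {n} (λ y → *-distribˡ-sum (Y x y) (λ z → M x z * N z y))) ⟩
    ∑ (λ x → ∑ λ y → ∑ λ z → Y x y * (M x z * N z y))
      ≡⟨ sum-cong-≗ {n} (λ x → ∑-comm (λ y z → Y x y * (M x z * N z y))) ⟩
    ∑ (λ x → ∑ λ z → ∑ λ y → Y x y * (M x z * N z y))
      ≡⟨ sum-cong-≗ {n} (λ x → sum-cong-≗ {n} (λ z → sum-cong-≗ {n} (λ y →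
           x*[y*z]≡y*[x*z] (Y x y) (M x z) (N z y)))) ⟩
    ∑ (λ x → ∑ λ z → ∑ λ y → M x z * (Y x y * N z y))
      ≡⟨ sum-cong-≗ {n} (λ x → sum-cong-≗ {n} (λ z → *-distribˡ-sum (M x z) (λ y → Y x y * N z y))) ⟨
    ⟨ M , Y ⊗ N ᵀ ⟩ ∎
    where
    open ≡-Reasoning
    x*[y*z]≡y*[x*z] : ∀ x y z → x * (y * z) ≡ y * (x * z)
    x*[y*z]≡y*[x*z] = solve-∀

  ⟨⟩-⊗-transposeˡ : ∀ Y M N → ⟨ Y , M ⊗ N ⟩ ≡ ⟨ M ᵀ ⊗ Y , N ⟩
  ⟨⟩-⊗-transposeˡ Y M N = begin
    ∑ (λ x → ∑ λ y → Y x y * ∑ (λ z → M x z * N z y))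
      ≡⟨ sum-cong-≗ {n} (λ x → sum-cong-≗ {n} (λ y → *-distribˡ-sum (Y x y) (λ z → M x z * N z y))) ⟩
    ∑ (λ x → ∑ λ y → ∑ λ z → Y x y * (M x z * N z y))
      ≡⟨ ∑-comm (λ x y → ∑ λ z → Y x y * (M x z * N z y)) ⟩
    ∑ (λ y → ∑ λ x → ∑ λ z → Y x y * (M x z * N z y))
      ≡⟨ sum-cong-≗ {n} (λ y → ∑-comm (λ x z → Y x y * (M x z * N z y))) ⟩
    ∑ (λ y → ∑ λ z → ∑ λ x → Y x y * (M x z * N z y))
      ≡⟨ ∑-comm (λ y z → ∑ λ x → Y x y * (M x z * N z y)) ⟩
    ∑ (λ z → ∑ λ y → ∑ λ x → Y x y * (M x z * N z y))
      ≡⟨ sum-cong-≗ {n} (λ z → sum-cong-≗ {n} (λ y → sum-cong-≗ {n} (λ x →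
           x*[y*z]≡[y*x]*z (Y x y) (M x z) (N z y)))) ⟩
    ∑ (λ z → ∑ λ y → ∑ λ x → M x z * Y x y * N z y)
      ≡⟨ sum-cong-≗ {n} (λ z → sum-cong-≗ {n} (λ y → *-distribʳ-sum (N z y) (λ x → M x z * Y x y))) ⟨
    ⟨ M ᵀ ⊗ Y , N ⟩ ∎
    where
    open ≡-Reasoning
    x*[y*z]≡[y*x]*z : ∀ x y z → x * (y * z) ≡ y * x * z
    x*[y*z]≡[y*x]*z = solve-∀

module _ {n r : ℕ} (c : Fin n → Fin n → Fin r) where

  Invariant : Matrix n → Set
  Invariant M = ∀ x y x' y' → c x y ≡ c x' y' → M x y ≡ M x' y'

  intersections : Fin n → Fin n → Fin r → Fin r → ℕ
  intersections x y i j = ∑ λ z → δ (c x z) i * δ (c z y) j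

  ∑-by-colours : ∀ (H : Fin r → Fin r → ℕ) x y →
                 ∑ (λ z → H (c x z) (c z y)) ≡ ∑ λ i → ∑ λ j → H i j * intersections x y i j
  ∑-by-colours H x y = begin
    ∑ (λ z → H (c x z) (c z y))
      ≡⟨ sum-cong-≗ {n} (λ z → sym (trans (δ-sum (c x z) (λ i → ∑ λ j → δ (c z y) j * H i j))
                                           (δ-sum (c z y) (H (c x z))))) ⟩
    ∑ (λ z → ∑ λ i → δ (c x z) i * ∑ λ j → δ (c z y) j * H i j)
      ≡⟨ sum-cong-≗ {n} (λ z → sum-cong-≗ {r} (λ i → *-distribˡ-sum (δ (c x z) i) (λ j → δ (c z y) j * H i j))) ⟩
    ∑ (λ z → ∑ λ i → ∑ λ j → δ (c x z) i * (δ (c z y) j * H i j))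
      ≡⟨ ∑-comm (λ z i → ∑ λ j → δ (c x z) i * (δ (c z y) j * H i j)) ⟩
    ∑ (λ i → ∑ λ z → ∑ λ j → δ (c x z) i * (δ (c z y) j * H i j))
      ≡⟨ sum-cong-≗ {r} (λ i → ∑-comm (λ z j → δ (c x z) i * (δ (c z y) j * H i j))) ⟩
    ∑ (λ i → ∑ λ j → ∑ λ z → δ (c x z) i * (δ (c z y) j * H i j))
      ≡⟨ sum-cong-≗ {r} (λ i → sum-cong-≗ {r} (λ j → sum-cong-≗ {n} (λ z →
           x*[y*z]≡z*[x*y] (δ (c x z) i) (δ (c z y) j) (H i j)))) ⟩
    ∑ (λ i → ∑ λ j → ∑ λ z → H i j * (δ (c x z) i * δ (c z y) j))
      ≡⟨ sum-cong-≗ {r} (λ i → sum-cong-≗ {r} (λ j → *-distribˡ-sum (H i j) (λ z → δ (c x z) i * δ (c z y) j))) ⟨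
    ∑ (λ i → ∑ λ j → H i j * intersections x y i j) ∎
    where
    open ≡-Reasoning
    x*[y*z]≡z*[x*y] : ∀ x y z → x * (y * z) ≡ z * (x * y)
    x*[y*z]≡z*[x*y] = solve-∀

module _ {n r : ℕ} {c : Fin n → Fin n → Fin r} (hcc : IsHCC n r c) where
  open IsHCC hcc

  intersections-invariant : ∀ x y x' y' → c x y ≡ c x' y' → ∀ i j →
                            intersections c x y i j ≡ intersections c x' y' i j
  intersections-invariant x y x' y' eq i j =
    trans (as-count x y) (trans (coherent i j (c x y) x y x' y' refl (sym eq)) (sym (as-count x' y')))
    where
    as-count : ∀ x y → intersections c x y i j ≡ count n (λ z → ⌊ c x z ≟ i ⌋ ∧ ⌊ c z y ≟ j ⌋)
    as-count x y = sym (trans (sum-map-allFin {n} (λ z → ⟦ ⌊ c x z ≟ i ⌋ ∧ ⌊ c z y ≟ j ⌋ ⟧))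
                              (sum-cong-≗ {n} (λ z → ⟦∧⟧ ⌊ c x z ≟ i ⌋ ⌊ c z y ≟ j ⌋)))

  valueOn : Matrix n → Fin r → ℕ
  valueOn M i = M (proj₁ (nonempty i)) (proj₁ (proj₂ (nonempty i)))

  invariant⇒valueOn : ∀ {M} → Invariant c M → ∀ x y → M x y ≡ valueOn M (c x y)
  invariant⇒valueOn inv x y = inv x y _ _ (sym (proj₂ (proj₂ (nonempty (c x y)))))

  ⊗-invariant : ∀ {M N} → Invariant c M → Invariant c N → Invariant c (M ⊗ N)
  ⊗-invariant {M} {N} invM invN x y x' y' eq = begin
    ∑ (λ z → M x z * N z y)
      ≡⟨ sum-cong-≗ {n} (λ z → cong₂ _*_ (invariant⇒valueOn invM x z) (invariant⇒valueOn invN z y)) ⟩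
    ∑ (λ z → valueOn M (c x z) * valueOn N (c z y))
      ≡⟨ ∑-by-colours c H x y ⟩
    ∑ (λ i → ∑ λ j → H i j * intersections c x y i j)
      ≡⟨ sum-cong-≗ {r} (λ i → sum-cong-≗ {r} (λ j → cong (H i j *_) (intersections-invariant x y x' y' eq i j))) ⟩
    ∑ (λ i → ∑ λ j → H i j * intersections c x' y' i j)
      ≡⟨ ∑-by-colours c H x' y' ⟨
    ∑ (λ z → valueOn M (c x' z) * valueOn N (c z y'))
      ≡⟨ sum-cong-≗ {n} (λ z → cong₂ _*_ (invariant⇒valueOn invM x' z) (invariant⇒valueOn invN z y')) ⟨
    ∑ (λ z → M x' z * N z y') ∎
    where
    open ≡-Reasoning
    H : Fin r → Fin r → ℕ
    H i j = valueOn M i * valueOn N j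

  ⊕-invariant : ∀ {M N} → Invariant c M → Invariant c N → Invariant c (M ⊕ N)
  ⊕-invariant invM invN x y x' y' eq = cong₂ _+_ (invM x y x' y' eq) (invN x y x' y' eq)

  ᵀ-invariant : ∀ {M} → Invariant c M → Invariant c (M ᵀ)
  ᵀ-invariant invM x y x' y' eq = invM y x y' x' (begin
    c y x             ≡⟨ Equivalence.to (transp-spec (c x y) x y) refl ⟩
    transp (c x y)    ≡⟨ cong transp eq ⟩
    transp (c x' y')  ≡⟨ Equivalence.to (transp-spec (c x' y') x' y') refl ⟨
    c y' x'           ∎)
    where open ≡-Reasoning

  𝟘-invariant : Invariant c 𝟘
  𝟘-invariant _ _ _ _ _ = refl

  𝟙-invariant : Invariant c 𝟙
  𝟙-invariant x y x' y' eq = begin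
    ⟦ ⌊ x ≟ y ⌋ ⟧              ≡⟨ cong ⟦_⟧ (⌊⌋-⇔ (diag-spec x y) (c x y ≟ diag) (x ≟ y)) ⟨
    ⟦ ⌊ c x y ≟ diag ⌋ ⟧       ≡⟨ cong (λ i → ⟦ ⌊ i ≟ diag ⌋ ⟧) eq ⟩
    ⟦ ⌊ c x' y' ≟ diag ⌋ ⟧     ≡⟨ cong ⟦_⟧ (⌊⌋-⇔ (diag-spec x' y') (c x' y' ≟ diag) (x' ≟ y')) ⟩
    ⟦ ⌊ x' ≟ y' ⌋ ⟧            ∎
    where open ≡-Reasoning

module WalkCounts {n r : ℕ} (c : Fin n → Fin n → Fin r) (g : Fin r) where

  adj : Matrix n
  adj x y = δ (c x y) g

  lazyAdj : Matrix n
  lazyAdj = 𝟙 ⊕ adj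

  walks : ℕ → Matrix n
  walks zero    = 𝟙
  walks (suc t) = lazyAdj ⊗ walks t

  -- stepsIn X t x y counts the pairs (lazy walk of length t from x to y, step of it along an edge of X),
  -- and load t Y e is the Y-weighted number of such pairs whose step is e.
  stepsIn : Matrix n → ℕ → Matrix n
  stepsIn X zero    = 𝟘
  stepsIn X (suc t) = X ⊗ walks t ⊕ lazyAdj ⊗ stepsIn X t

  load : ℕ → Matrix n → Matrix n
  load zero    Y = 𝟘
  load (suc t) Y = Y ⊗ walks t ᵀ ⊕ load t (lazyAdj ᵀ ⊗ Y)

  ⟨⟩-stepsIn : ∀ t X Y → ⟨ Y , stepsIn X t ⟩ ≡ ⟨ X , load t Y ⟩
  ⟨⟩-stepsIn zero    X Y = trans (⟨⟩-zeroʳ Y) (sym (⟨⟩-zeroʳ X))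
  ⟨⟩-stepsIn (suc t) X Y = begin
    ⟨ Y , X ⊗ walks t ⊕ lazyAdj ⊗ stepsIn X t ⟩
      ≡⟨ ⟨⟩-distribˡ-⊕ Y (X ⊗ walks t) (lazyAdj ⊗ stepsIn X t) ⟩
    ⟨ Y , X ⊗ walks t ⟩ + ⟨ Y , lazyAdj ⊗ stepsIn X t ⟩
      ≡⟨ cong₂ _+_ (⟨⟩-⊗-transposeʳ Y X (walks t)) (⟨⟩-⊗-transposeˡ Y lazyAdj (stepsIn X t)) ⟩
    ⟨ X , Y ⊗ walks t ᵀ ⟩ + ⟨ lazyAdj ᵀ ⊗ Y , stepsIn X t ⟩
      ≡⟨ cong (⟨ X , Y ⊗ walks t ᵀ ⟩ +_) (⟨⟩-stepsIn t X (lazyAdj ᵀ ⊗ Y)) ⟩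
    ⟨ X , Y ⊗ walks t ᵀ ⟩ + ⟨ X , load t (lazyAdj ᵀ ⊗ Y) ⟩
      ≡⟨ ⟨⟩-distribˡ-⊕ X (Y ⊗ walks t ᵀ) (load t (lazyAdj ᵀ ⊗ Y)) ⟨
    ⟨ X , load (suc t) Y ⟩ ∎
    where open ≡-Reasoning

  adj≤lazyAdj : ∀ x y → adj x y ≤ lazyAdj x y
  adj≤lazyAdj x y = m≤n+m (adj x y) (𝟙 x y)

  stepsIn-adj-≤ : ∀ t x y → stepsIn adj t x y ≤ t * walks t x y
  stepsIn-adj-≤ zero    x y = z≤n
  stepsIn-adj-≤ (suc t) x y = begin
    ∑ (λ z → adj x z * walks t z y) + ∑ (λ z → lazyAdj x z * stepsIn adj t z y)
      ≤⟨ +-mono-≤ (∑-mono-≤ λ z → *-monoˡ-≤ (walks t z y) (adj≤lazyAdj x z))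
                  (∑-mono-≤ λ z → *-monoʳ-≤ (lazyAdj x z) (stepsIn-adj-≤ t z y)) ⟩
    walks (suc t) x y + ∑ (λ z → lazyAdj x z * (t * walks t z y))
      ≡⟨ cong (walks (suc t) x y +_) (sum-cong-≗ {n} λ z → x*[y*z]≡y*[x*z] (lazyAdj x z) t (walks t z y)) ⟩
    walks (suc t) x y + ∑ (λ z → t * (lazyAdj x z * walks t z y))
      ≡⟨ cong (walks (suc t) x y +_) (*-distribˡ-sum t (λ z → lazyAdj x z * walks t z y)) ⟨
    suc t * walks (suc t) x y ∎
    where
    open ≤-Reasoning
    x*[y*z]≡y*[x*z] : ∀ x y z → x * (y * z) ≡ y * (x * z)
    x*[y*z]≡y*[x*z] = solve-∀

  walks-diagonal-positive : ∀ t u → 0 < walks t u u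
  walks-diagonal-positive zero    u = ≤-reflexive (sym (δ-refl u))
  walks-diagonal-positive (suc t) u =
    ≤-trans (*-mono-≤ (≤-trans (≤-reflexive (sym (δ-refl u))) (m≤m+n (𝟙 u u) (adj u u)))
                      (walks-diagonal-positive t u))
            (term≤∑ (λ z → lazyAdj u z * walks t z u) u)

  walks-positive : ∀ {u v ℓ t} → Walk c g u v ℓ → ℓ ≤ t → 0 < walks t u v
  walks-positive {u} {t = t} here _ = walks-diagonal-positive t u
  walks-positive {u} {v} {t = suc t} (step {v = w} e rest) (s≤s ℓ≤t) =
    ≤-trans (*-mono-≤ (≤-trans (≤-reflexive (sym edge)) (adj≤lazyAdj u w)) (walks-positive rest ℓ≤t))
            (term≤∑ (λ z → lazyAdj u z * walks t z v) w)
    where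
    edge : adj u w ≡ 1
    edge = trans (cong (λ i → δ i g) e) (δ-refl g)

  module _ (S : Subset n) where

    boundaryEdges : Matrix n
    boundaryEdges x y = ⟦ ⌊ c x y ≟ g ⌋ ∧ lookup S x ∧ not (lookup S y) ⟧

    boundaryEdges≤adj : ∀ x y → boundaryEdges x y ≤ adj x y
    boundaryEdges≤adj x y with ⌊ c x y ≟ g ⌋ | lookup S x ∧ not (lookup S y)
    ... | true  | true  = ≤-refl
    ... | true  | false = z≤n
    ... | false | _     = z≤n

    inside≢outside : ∀ {x z} → lookup S x ≡ true → lookup S z ≡ false → x ≢ z
    inside≢outside x∈S z∉S refl with () ← trans (sym x∈S) z∉S

    -- Every lazy walk from S to its complement has a step leaving S, and that step is a boundary edge.
    walks≤stepsIn-boundaryEdges : ∀ t {x y} → lookup S x ≡ true → lookup S y ≡ false →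
                                  walks t x y ≤ stepsIn boundaryEdges t x y
    walks≤stepsIn-boundaryEdges zero {x} {y} x∈S y∉S = ≤-reflexive (δ-≢ (inside≢outside x∈S y∉S))
    walks≤stepsIn-boundaryEdges (suc t) {x} {y} x∈S y∉S = begin
      ∑ (λ z → lazyAdj x z * walks t z y)
        ≤⟨ ∑-mono-≤ (λ z → first-step z (lookup S z) refl) ⟩
      ∑ (λ z → boundaryEdges x z * walks t z y + lazyAdj x z * stepsIn boundaryEdges t z y)
        ≡⟨ ∑-distrib-+ {n} _ _ ⟩
      stepsIn boundaryEdges (suc t) x y ∎
      where
      open ≤-Reasoning
      first-step : ∀ z b → lookup S z ≡ b →
                   lazyAdj x z * walks t z y ≤ boundaryEdges x z * walks t z y + lazyAdj x z * stepsIn boundaryEdges t z y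
      first-step z true  z∈S = ≤-trans (*-monoʳ-≤ (lazyAdj x z) (walks≤stepsIn-boundaryEdges t z∈S y∉S)) (m≤n+m _ _)
      first-step z false z∉S = ≤-trans (≤-reflexive (cong (_* walks t z y) leaves)) (m≤m+n _ _)
        where
        leaves : lazyAdj x z ≡ boundaryEdges x z
        leaves rewrite δ-≢ (inside≢outside x∈S z∉S) | x∈S | z∉S = cong ⟦_⟧ (sym (∧-identityʳ ⌊ c x z ≟ g ⌋))

module _ {n r : ℕ} {c : Fin n → Fin n → Fin r} (hcc : IsHCC n r c) where

  record Reciprocal (N : Matrix n) : Set where
    field
      scale            : ℕ
      scale>0          : 0 < scale
      weight           : Matrix n
      weight-invariant : Invariant c weight
      weight*N≡scale   : ∀ x y → weight x y * N x y ≡ scale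

  reciprocal : ∀ {N} → Invariant c N → (∀ x y → 0 < N x y) → Reciprocal N
  reciprocal {N} invN N>0 = record
    { scale            = ∑ (valueOn hcc N) !
    ; scale>0          = 1≤n! (∑ (valueOn hcc N))
    ; weight           = λ x y → quotient (c x y)
    ; weight-invariant = λ x y x' y' eq → cong quotient eq
    ; weight*N≡scale   = λ x y → trans (cong (quotient (c x y) *_) (invariant⇒valueOn hcc invN x y))
                                       (sym (_∣_.equality (divides-scale (c x y))))
    }
    where
    divides-scale : ∀ i → valueOn hcc N i ∣ ∑ (valueOn hcc N) !
    divides-scale = ∣∑! (valueOn hcc N) (λ i → N>0 _ _)
    quotient : Fin r → ℕ
    quotient i = _∣_.quotient (divides-scale i)

  module _ (g : Fin r) where
    open WalkCounts c g

    lazyAdj-invariant : Invariant c lazyAdj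
    lazyAdj-invariant = ⊕-invariant hcc (𝟙-invariant hcc) (λ _ _ _ _ eq → cong (λ i → δ i g) eq)

    walks-invariant : ∀ t → Invariant c (walks t)
    walks-invariant zero    = 𝟙-invariant hcc
    walks-invariant (suc t) = ⊗-invariant hcc lazyAdj-invariant (walks-invariant t)

    load-invariant : ∀ t {Y} → Invariant c Y → Invariant c (load t Y)
    load-invariant zero    _    = 𝟘-invariant hcc
    load-invariant (suc t) invY =
      ⊕-invariant hcc (⊗-invariant hcc invY (ᵀ-invariant hcc (walks-invariant t)))
                      (load-invariant t (⊗-invariant hcc (ᵀ-invariant hcc lazyAdj-invariant) invY))

    ⟨⟩-on-edges : ∀ {Z L} → (∀ x y → Z x y ≤ adj x y) → Invariant c L →
                  ⟨ Z , L ⟩ ≡ total Z * valueOn hcc L g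
    ⟨⟩-on-edges {Z} {L} Z≤adj invL =
      trans (sum-cong-≗ {n} λ x → sum-cong-≗ {n} λ y → on-edge x y) (⟨⟩-constʳ Z (valueOn hcc L g))
      where
      on-edge : ∀ x y → Z x y * L x y ≡ Z x y * valueOn hcc L g
      on-edge x y with c x y ≟ g
      ... | yes e = cong (Z x y *_) (trans (invariant⇒valueOn hcc invL x y) (cong (valueOn hcc L) e))
      ... | no ne = trans (cong (_* L x y) Zxy≡0) (sym (cong (_* valueOn hcc L g) Zxy≡0))
        where
        Zxy≡0 : Z x y ≡ 0
        Zxy≡0 = n≤0⇒n≡0 (≤-trans (Z≤adj x y) (≤-reflexive (δ-≢ ne)))

eliminate-load : ∀ {n k d s t b L M} .{{_ : NonZero n}} .{{_ : NonZero M}} →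
               s * (t * M) ≤ b * L → n * k * L ≤ n * (n * (d * M)) → k * s * t ≤ n * d * b
eliminate-load {n} {k} {d} {s} {t} {b} {L} {M} lower upper = *-cancelʳ-≤ (k * s * t) (n * d * b) M (begin
  k * s * t * M     ≡⟨ x*y*z*w≡x*[y*[z*w]] k s t M ⟩
  k * (s * (t * M)) ≤⟨ *-monoʳ-≤ k lower ⟩
  k * (b * L)       ≡⟨ x*[y*z]≡y*[x*z] k b L ⟩
  b * (k * L)       ≤⟨ *-monoʳ-≤ b kL≤ndM ⟩
  b * (n * (d * M)) ≡⟨ x*[y*[z*w]]≡y*z*x*w b n d M ⟩
  n * d * b * M     ∎)
  where
  open ≤-Reasoning
  kL≤ndM : k * L ≤ n * (d * M)
  kL≤ndM = *-cancelˡ-≤ n (≤-trans (≤-reflexive (sym (*-assoc n k L))) upper)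
  x*y*z*w≡x*[y*[z*w]] : ∀ x y z w → x * y * z * w ≡ x * (y * (z * w))
  x*y*z*w≡x*[y*[z*w]] = solve-∀
  x*[y*z]≡y*[x*z] : ∀ x y z → x * (y * z) ≡ y * (x * z)
  x*[y*z]≡y*[x*z] = solve-∀
  x*[y*[z*w]]≡y*z*x*w : ∀ x y z w → x * (y * (z * w)) ≡ y * z * x * w
  x*[y*[z*w]]≡y*z*x*w = solve-∀

large-complement-bound : ∀ {n k d s t b} .{{_ : NonZero n}} →
                         s + t ≡ n → 2 * s ≤ n → k * s * t ≤ n * d * b → k * s ≤ 2 * d * b
large-complement-bound {n} {k} {d} {s} {t} {b} s+t≡n 2s≤n kst≤ndb = *-cancelʳ-≤ (k * s) (2 * d * b) n (begin
  k * s * n         ≤⟨ *-monoʳ-≤ (k * s) n≤2t ⟩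
  k * s * (2 * t)   ≡⟨ x*[2*y]≡2*x*y (k * s) t ⟩
  2 * (k * s * t)   ≤⟨ *-monoʳ-≤ 2 kst≤ndb ⟩
  2 * (n * d * b)   ≡⟨ 2*[x*y*z]≡2*y*z*x n d b ⟩
  2 * d * b * n     ∎)
  where
  open ≤-Reasoning
  [x+y]+[x+y]≡2x+2y : ∀ x y → (x + y) + (x + y) ≡ 2 * x + 2 * y
  [x+y]+[x+y]≡2x+2y = solve-∀
  n≤2t : n ≤ 2 * t
  n≤2t = +-cancelˡ-≤ n n (2 * t) (begin
    n + n                 ≡⟨ cong (λ m → m + m) s+t≡n ⟨
    (s + t) + (s + t)     ≡⟨ [x+y]+[x+y]≡2x+2y s t ⟩
    2 * s + 2 * t         ≤⟨ +-monoˡ-≤ (2 * t) 2s≤n ⟩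
    n + 2 * t             ∎)
  x*[2*y]≡2*x*y : ∀ x y → x * (2 * y) ≡ 2 * (x * y)
  x*[2*y]≡2*x*y = solve-∀
  2*[x*y*z]≡2*y*z*x : ∀ x y z → 2 * (x * y * z) ≡ 2 * y * z * x
  2*[x*y*z]≡2*y*z*x = solve-∀

module FlowBounds {n r : ℕ} {c : Fin n → Fin n → Fin r} (hcc : IsHCC n r c) {g : Fin r} {k d : ℕ}
                 (degree : HasDegree c g k) (diameter : HasDiameter c g d) (S : Subset n) where
  open WalkCounts c g

  walks-within-diameter>0 : ∀ x y → 0 < walks d x y
  walks-within-diameter>0 x y with proj₁ diameter x y
  ... | _ , ℓ≤d , walk = walks-positive walk ℓ≤d

  open Reciprocal (reciprocal hcc (walks-invariant hcc g d) walks-within-diameter>0) public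

  edgeLoad : ℕ
  edgeLoad = valueOn hcc (load d weight) g

  load-invariant-weight : Invariant c (load d weight)
  load-invariant-weight = load-invariant hcc g d weight-invariant

  outside : ℕ
  outside = ∑ λ y → ⟦ not (lookup S y) ⟧

  total-adj : total adj ≡ n * k
  total-adj = trans (sum-cong-≗ {n} λ x → trans (sym (sum-map-allFin (adj x))) (degree x)) (∑-const {n} k)

  total-boundaryEdges : total (boundaryEdges S) ≡ boundary c g S
  total-boundaryEdges = sym (trans (sum-map-allFin {n} _) (sum-cong-≗ {n} λ x → sum-map-allFin (boundaryEdges S x)))

  cutPairs≤boundaryLoad : ∣ S ∣ * (outside * scale) ≤ boundary c g S * edgeLoad
  cutPairs≤boundaryLoad = begin
    ∣ S ∣ * (outside * scale)
      ≡⟨ cong (_* (outside * scale)) (∣p∣≡∑ S) ⟩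
    ∑ (λ x → ⟦ lookup S x ⟧) * (outside * scale)
      ≡⟨ *-distribʳ-sum (outside * scale) (λ x → ⟦ lookup S x ⟧) ⟩
    ∑ (λ x → ⟦ lookup S x ⟧ * (outside * scale))
      ≡⟨ sum-cong-≗ {n} (λ x → cong (⟦ lookup S x ⟧ *_) (*-distribʳ-sum scale (λ y → ⟦ not (lookup S y) ⟧))) ⟩
    ∑ (λ x → ⟦ lookup S x ⟧ * ∑ λ y → ⟦ not (lookup S y) ⟧ * scale)
      ≡⟨ sum-cong-≗ {n} (λ x → *-distribˡ-sum ⟦ lookup S x ⟧ (λ y → ⟦ not (lookup S y) ⟧ * scale)) ⟩
    ∑ (λ x → ∑ λ y → ⟦ lookup S x ⟧ * (⟦ not (lookup S y) ⟧ * scale))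
      ≤⟨ ∑-mono-≤ (λ x → ∑-mono-≤ (crossing x)) ⟩
    ⟨ weight , stepsIn (boundaryEdges S) d ⟩
      ≡⟨ ⟨⟩-stepsIn d (boundaryEdges S) weight ⟩
    ⟨ boundaryEdges S , load d weight ⟩
      ≡⟨ ⟨⟩-on-edges hcc g (boundaryEdges≤adj S) load-invariant-weight ⟩
    total (boundaryEdges S) * edgeLoad
      ≡⟨ cong (_* edgeLoad) total-boundaryEdges ⟩
    boundary c g S * edgeLoad ∎
    where
    open ≤-Reasoning
    crossing : ∀ x y → ⟦ lookup S x ⟧ * (⟦ not (lookup S y) ⟧ * scale) ≤ weight x y * stepsIn (boundaryEdges S) d x y
    crossing x y with lookup S x in x∈S | lookup S y in y∈S
    ... | true  | false = begin
      1 * (1 * scale)                         ≡⟨ trans (*-identityˡ _) (*-identityˡ scale) ⟩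
      scale                                   ≡⟨ weight*N≡scale x y ⟨
      weight x y * walks d x y                ≤⟨ *-monoʳ-≤ (weight x y) (walks≤stepsIn-boundaryEdges S d x∈S y∈S) ⟩
      weight x y * stepsIn (boundaryEdges S) d x y ∎
    ... | true  | true  = z≤n
    ... | false | _     = z≤n

  edgeLoad≤walkLengths : n * k * edgeLoad ≤ n * (n * (d * scale))
  edgeLoad≤walkLengths = begin
    n * k * edgeLoad                     ≡⟨ cong (_* edgeLoad) total-adj ⟨
    total adj * edgeLoad                 ≡⟨ ⟨⟩-on-edges hcc g (λ _ _ → ≤-refl) load-invariant-weight ⟨
    ⟨ adj , load d weight ⟩              ≡⟨ ⟨⟩-stepsIn d adj weight ⟨
    ⟨ weight , stepsIn adj d ⟩           ≤⟨ ∑-mono-≤ (λ x → ∑-mono-≤ (λ y → at-most-d-steps x y)) ⟩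
    ∑ {n} (λ _ → ∑ {n} λ _ → d * scale) ≡⟨ sum-cong-≗ {n} (λ _ → ∑-const {n} (d * scale)) ⟩
    ∑ {n} (λ _ → n * (d * scale))        ≡⟨ ∑-const {n} (n * (d * scale)) ⟩
    n * (n * (d * scale))                ∎
    where
    open ≤-Reasoning
    at-most-d-steps : ∀ x y → weight x y * stepsIn adj d x y ≤ d * scale
    at-most-d-steps x y = begin
      weight x y * stepsIn adj d x y     ≤⟨ *-monoʳ-≤ (weight x y) (stepsIn-adj-≤ d x y) ⟩
      weight x y * (d * walks d x y)     ≡⟨ x*[y*z]≡y*[x*z] (weight x y) d (walks d x y) ⟩
      d * (weight x y * walks d x y)     ≡⟨ cong (d *_) (weight*N≡scale x y) ⟩
      d * scale                          ∎
      where
      x*[y*z]≡y*[x*z] : ∀ x y z → x * (y * z) ≡ y * (x * z)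
      x*[y*z]≡y*[x*z] = solve-∀

proposition2p8 : (n r : ℕ) (c : Fin n → Fin n → Fin r) → IsHCC n r c →
                 (g : Fin r) (k d : ℕ) →
                 Symmetric c g → Connected c g → HasDegree c g k → HasDiameter c g d →
                 (S : Subset n) → Nonempty S → 2 * ∣ S ∣ ≤ n →
                 k * ∣ S ∣ ≤ 2 * d * boundary c g S
proposition2p8 n r c hcc g k d _ _ degree diameter S (x , _) 2∣S∣≤n =
  large-complement-bound {k = k} {d} {∣ S ∣} {outside} {boundary c g S} (∣p∣+∑⟦not⟧≡n S) 2∣S∣≤n
    (eliminate-load {n} {k} {d} {∣ S ∣} {outside} {boundary c g S}
       cutPairs≤boundaryLoad edgeLoad≤walkLengths)
  where
  open FlowBounds hcc degree diameter S
  instance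
    n≢0 : NonZero n
    n≢0 = nonZeroIndex x
    scale≢0 : NonZero scale
    scale≢0 = >-nonZero scale>0
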